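{- For every $m\in\mathbb{Z}$, as operators on $\mathbb{Q}(q)\otimes\mathrm{NSym}$, \[ \mathbb{B}_m = \sum_{i\ge0}(-q)^i\,\widetilde{\mathbb{B}}_{m+i}\,F_{1^i}^\perp. \]
   Context: $\mathrm{NSym}$ is the free associative algebra over $\mathbb{Q}$ on $H_1,H_2,\dots$ ($H_0=1$, $H_{ -r}=0$ for $r>0$), graded dual to $\mathrm{QSym}$ via $\langle H_{\alpha_1}\cdots H_{\alpha_k},M_\beta\rangle=\delta_{\alpha\beta}$ ($M_\beta$ monomial quasisymmetric functions), coproduct $\Delta(H_j)=\sum_iH_i\otimes H_{j-i}$. For $F\in\mathrm{QSym}$, $F^\perp$ satisfies $\langle F^\perp(H),G\rangle=\langle H,FG\rangle$ (extended $q$-linearly). $F_i=\sum_{\gamma\models i}M_\gamma$ ($F_0=1$) and $F_{1^i}=M_{1^i}$ are fundamental quasisymmetric functions. $\mathbb{B}_m=\sum_{i\ge0}(-1)^iH_{m+i}F_{1^i}^\perp$ and $\widetilde{\mathbb{B}}_m=\sum_{i\ge0}q^i\mathbb{B}_{m+i}F_i^\perp$ (composition of operators, rightmost applied first). -}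

module Defs where

open import Data.Nat as ℕ using (ℕ; zero; suc; _≤_)
open import Data.Integer as ℤ using (ℤ; +_; -[1+_])
open import Data.Rational as ℚ using (ℚ; 0ℚ; 1ℚ)
open import Data.List using (List; []; _∷_; map; concatMap; upTo; replicate)
open import Data.Nat.ListAction using (sum)
open import Data.List.Properties using (≡-dec)
open import Data.List.Relation.Unary.All using (All)
open import Data.Product using (_×_; _,_)
open import Relation.Binary.PropositionalEquality using (_≡_)
open import Relation.Nullary using (yes; no)

Comp : Set
Comp = List ℕ

IsComp : Comp → Set
IsComp α = All (λ a → 1 ≤ a) α

size : Comp → ℕ
size = sum

_≟c_ : (α β : Comp) → Relation.Nullary.Dec (α ≡ β)
_≟c_ = ≡-dec ℕ._≟_

bumpHead : Comp → Comp
bumpHead []      = []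
bumpHead (a ∷ c) = suc a ∷ c

comps : ℕ → List Comp
comps zero          = [] ∷ []
comps (suc zero)    = (1 ∷ []) ∷ []
comps (suc (suc n)) = concatMap (λ c → (1 ∷ c) ∷ bumpHead c ∷ []) (comps (suc n))

compsUpTo : ℕ → List Comp
compsUpTo n = concatMap comps (upTo (suc n))

-- QSym, in the monomial basis: a formal sum  Σ c M_γ

QSym : Set
QSym = List (ℚ × Comp)

-- quasi-shuffles: M_α M_β = Σ_{γ ∈ qsh α β} M_γ  (with multiplicity)
qsh : Comp → Comp → List Comp
qsh []      β       = β ∷ []
qsh (a ∷ α) []      = (a ∷ α) ∷ []
qsh (a ∷ α) (b ∷ β) =
  Data.List._++_ (map (a ∷_) (qsh α (b ∷ β)))
  (Data.List._++_ (map (b ∷_) (qsh (a ∷ α) β))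
                  (map (ℕ._+_ a b ∷_) (qsh α β)))

_·M_ : QSym → Comp → QSym
F ·M β = concatMap (λ { (c , γ) → map (c ,_) (qsh γ β) }) F

-- ⟨ H_α , G ⟩  (H_α dual to M_α)
pairH : Comp → QSym → ℚ
pairH α [] = 0ℚ
pairH α ((c , γ) ∷ G) with γ ≟c α
... | yes _ = ℚ._+_ c (pairH α G)
... | no  _ = pairH α G

-- fundamental quasisymmetric functions F_i = Σ_{γ ⊨ i} M_γ  and  F_{1^i} = M_{1^i}
Fn : ℕ → QSym
Fn i = map (1ℚ ,_) (comps i)

F1n : ℕ → QSym
F1n i = (1ℚ , replicate i 1) ∷ []

-- ℚ[q] ⊗ NSym : formal sums of terms  c q^k H_α

Term : Set
Term = ℚ × ℕ × Comp

Elem : Set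
Elem = List Term

H : Comp → Elem
H α = (1ℚ , 0 , α) ∷ []

coeff : ℕ → Comp → Elem → ℚ
coeff k γ [] = 0ℚ
coeff k γ ((c , j , α) ∷ x) with ℕ._≟_ j k | α ≟c γ
... | yes _ | yes _ = ℚ._+_ c (coeff k γ x)
... | _     | _     = coeff k γ x

infix 4 _≈_
_≈_ : Elem → Elem → Set
x ≈ y = ∀ k γ → coeff k γ x ≡ coeff k γ y

lift : (Term → Elem) → Elem → Elem
lift = concatMap

scale : ℚ → ℕ → Elem → Elem
scale c k = map (λ { (d , j , α) → (ℚ._*_ c d , ℕ._+_ k j , α) })

-- left multiplication by H_n, n ∈ ℤ  (H_0 = 1, H_{-r} = 0)
Hmul : ℤ → Elem → Elem
Hmul (+ zero)  x = x
Hmul (+ suc j) x = map (λ { (c , k , α) → (c , k , suc j ∷ α) }) x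
Hmul -[1+ _ ]  x = []

-- F^⊥ H_α = Σ_β ⟨H_α , F M_β⟩ H_β   (only |β| ≤ |α| can contribute)
perp : QSym → Elem → Elem
perp F = lift (λ { (c , k , α) →
  map (λ β → (ℚ._*_ c (pairH α (F ·M β)) , k , β)) (compsUpTo (size α)) })

sign : ℕ → ℚ
sign zero    = 1ℚ
sign (suc i) = ℚ.-_ (sign i)

-- Σ_{i ≥ 0} f i t, truncated at i ≤ |α| (the degree of the term t = c q^k H_α);
-- in all uses below the summands with i > |α| vanish since F_i^⊥, F_{1^i}^⊥
-- lower degree by i.
sumDeg : (ℕ → Elem → Elem) → Elem → Elem
sumDeg f = lift (λ { t@(c , k , α) → concatMap (λ i → f i (t ∷ [])) (upTo (suc (size α))) })

𝔹 : ℤ → Elem → Elem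
𝔹 m = sumDeg (λ i t → scale (sign i) 0 (Hmul (ℤ._+_ m (+ i)) (perp (F1n i) t)))

𝔹̃ : ℤ → Elem → Elem
𝔹̃ m = sumDeg (λ i t → scale 1ℚ i (𝔹 (ℤ._+_ m (+ i)) (perp (Fn i) t)))

RHS : ℤ → Elem → Elem
RHS m = sumDeg (λ i t → scale (sign i) i (𝔹̃ (ℤ._+_ m (+ i)) (perp (F1n i) t)))

-- Work with transposes. A linear form on ℚ[q] ⊗ NSym is a function of (k, β), the coefficient of
-- q^k H_γ is the form δ k γ, and each of H_n·, c q^s· and F^⊥ has an explicit transpose; that of F^⊥
-- comes from quasi-shuffle duality: ⟨H_α, M_γ M_β⟩ is the multiplicity of β in qshDual γ α.
-- Since F_j = h_j and F_{1^i} = e_i, the right-hand side is Σ_n q^n 𝔹_{m+n} (Σ_{i+j=n} (-1)^i e_i h_j)^⊥,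
-- and Σ_{i+j=n} (-1)^i e_i h_j = δ_{n0} leaves 𝔹_m. That identity is proved in transposed form, by
-- induction on α, splitting off its first part.

module Submission where

open import Defs
open import Data.Bool using (Bool; true; false; _∧_; T)
open import Data.Bool.Properties using (∧-zeroʳ)
open import Data.Empty using (⊥-elim)
open import Data.Integer as ℤ using (ℤ; -[1+_])
import Data.Integer.Properties as ℤₚ
open import Data.List using (List; []; _∷_; _++_; map; concatMap; applyUpTo; upTo; replicate)
import Data.List.Properties as Listₚ
open import Data.List.Relation.Unary.All as All using (All; []; _∷_)
import Data.List.Relation.Unary.All.Properties as All
open import Data.Nat as ℕ using (ℕ; zero; suc; _∸_; _≤_; _<_; z≤n; s≤s; _≡ᵇ_)
import Data.Nat.Properties as ℕₚ
open import Data.Product using (_×_; _,_)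
open import Data.Rational using (ℚ; 0ℚ; 1ℚ; _+_; _*_; -_)
import Data.Rational.Properties as ℚₚ
open import Data.Rational.Solver using (module +-*-Solver)
open import Function using (_∘_; id)
open import Relation.Nullary using (¬_; yes; no)
open import Relation.Binary.PropositionalEquality
open ≡-Reasoning
open +-*-Solver using (solve; _:=_; _:+_; _:*_; :-_; con)

∑ : {A : Set} → List A → (A → ℚ) → ℚ
∑ []       f = 0ℚ
∑ (x ∷ xs) f = f x + ∑ xs f

syntax ∑ xs (λ x → e) = ∑[ x ∈ xs ] e

∑< : ℕ → (ℕ → ℚ) → ℚ
∑< zero    f = 0ℚ
∑< (suc n) f = f 0 + ∑< n (f ∘ suc)

syntax ∑< n (λ i → e) = ∑[ i < n ] e

module _ {A : Set} where

  ∑-++ : (xs ys : List A) (f : A → ℚ) → ∑ (xs ++ ys) f ≡ ∑ xs f + ∑ ys f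
  ∑-++ []       ys f = sym (ℚₚ.+-identityˡ _)
  ∑-++ (x ∷ xs) ys f = trans (cong (f x +_) (∑-++ xs ys f)) (sym (ℚₚ.+-assoc (f x) _ _))

  ∑-cong : (xs : List A) {f g : A → ℚ} → (∀ x → f x ≡ g x) → ∑ xs f ≡ ∑ xs g
  ∑-cong []       f≡g = refl
  ∑-cong (x ∷ xs) f≡g = cong₂ _+_ (f≡g x) (∑-cong xs f≡g)

  ∑-congᴬ : {P : A → Set} {xs : List A} {f g : A → ℚ} →
            All P xs → (∀ {x} → P x → f x ≡ g x) → ∑ xs f ≡ ∑ xs g
  ∑-congᴬ []         f≡g = refl
  ∑-congᴬ (px ∷ pxs) f≡g = cong₂ _+_ (f≡g px) (∑-congᴬ pxs f≡g)

  ∑-zero : (xs : List A) {f : A → ℚ} → (∀ x → f x ≡ 0ℚ) → ∑ xs f ≡ 0ℚ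
  ∑-zero []       f≡0 = refl
  ∑-zero (x ∷ xs) f≡0 = cong₂ _+_ (f≡0 x) (∑-zero xs f≡0)

  ∑-+ : (xs : List A) (f g : A → ℚ) → ∑[ x ∈ xs ] (f x + g x) ≡ ∑ xs f + ∑ xs g
  ∑-+ []       f g = refl
  ∑-+ (x ∷ xs) f g = trans (cong (f x + g x +_) (∑-+ xs f g))
    (solve 4 (λ a b c d → (a :+ b) :+ (c :+ d) := (a :+ c) :+ (b :+ d)) refl (f x) (g x) (∑ xs f) (∑ xs g))

  ∑-*ˡ : (xs : List A) (c : ℚ) (f : A → ℚ) → ∑[ x ∈ xs ] (c * f x) ≡ c * ∑ xs f
  ∑-*ˡ []       c f = sym (ℚₚ.*-zeroʳ c)
  ∑-*ˡ (x ∷ xs) c f = trans (cong (c * f x +_) (∑-*ˡ xs c f)) (sym (ℚₚ.*-distribˡ-+ c (f x) _))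

  ∑-*ʳ : (xs : List A) (f : A → ℚ) (c : ℚ) → ∑ xs f * c ≡ ∑[ x ∈ xs ] (f x * c)
  ∑-*ʳ xs f c = begin
    ∑ xs f * c            ≡⟨ ℚₚ.*-comm _ c ⟩
    c * ∑ xs f            ≡⟨ ∑-*ˡ xs c f ⟨
    ∑[ x ∈ xs ] (c * f x) ≡⟨ ∑-cong xs (λ x → ℚₚ.*-comm c (f x)) ⟩
    ∑[ x ∈ xs ] (f x * c) ∎

  ∑-neg : (xs : List A) (f : A → ℚ) → ∑[ x ∈ xs ] (- f x) ≡ - ∑ xs f
  ∑-neg []       f = refl
  ∑-neg (x ∷ xs) f = trans (cong (- f x +_) (∑-neg xs f)) (sym (ℚₚ.neg-distrib-+ (f x) _))

  ∑-map : {B : Set} (xs : List B) (h : B → A) (f : A → ℚ) → ∑ (map h xs) f ≡ ∑ xs (f ∘ h)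
  ∑-map []       h f = refl
  ∑-map (x ∷ xs) h f = cong (f (h x) +_) (∑-map xs h f)

  ∑-concatMap : {B : Set} (xs : List B) (h : B → List A) (f : A → ℚ) →
                ∑ (concatMap h xs) f ≡ ∑[ x ∈ xs ] ∑ (h x) f
  ∑-concatMap []       h f = refl
  ∑-concatMap (x ∷ xs) h f = trans (∑-++ (h x) (concatMap h xs) f) (cong (∑ (h x) f +_) (∑-concatMap xs h f))

∑-swap : {A B : Set} (xs : List A) (ys : List B) (f : A → B → ℚ) →
         ∑[ x ∈ xs ] ∑[ y ∈ ys ] f x y ≡ ∑[ y ∈ ys ] ∑[ x ∈ xs ] f x y
∑-swap []       ys f = sym (∑-zero ys (λ _ → refl))
∑-swap (x ∷ xs) ys f = trans (cong (∑ ys (f x) +_) (∑-swap xs ys f)) (sym (∑-+ ys (f x) _))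

∑-applyUpTo : {A : Set} (h : ℕ → A) (n : ℕ) (f : A → ℚ) → ∑ (applyUpTo h n) f ≡ ∑< n (f ∘ h)
∑-applyUpTo h zero    f = refl
∑-applyUpTo h (suc n) f = cong (f (h 0) +_) (∑-applyUpTo (h ∘ suc) n f)

∑-upTo : (n : ℕ) (f : ℕ → ℚ) → ∑ (upTo n) f ≡ ∑< n f
∑-upTo = ∑-applyUpTo id

∑<-cong< : (n : ℕ) {f g : ℕ → ℚ} → (∀ {i} → i < n → f i ≡ g i) → ∑< n f ≡ ∑< n g
∑<-cong< zero    f≡g = refl
∑<-cong< (suc n) f≡g = cong₂ _+_ (f≡g (s≤s z≤n)) (∑<-cong< n (f≡g ∘ s≤s))

∑<-cong : (n : ℕ) {f g : ℕ → ℚ} → (∀ i → f i ≡ g i) → ∑< n f ≡ ∑< n g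
∑<-cong n f≡g = ∑<-cong< n (λ {i} _ → f≡g i)

∑<-zero : (n : ℕ) {f : ℕ → ℚ} → (∀ i → f i ≡ 0ℚ) → ∑< n f ≡ 0ℚ
∑<-zero zero    f≡0 = refl
∑<-zero (suc n) f≡0 = cong₂ _+_ (f≡0 0) (∑<-zero n (f≡0 ∘ suc))

∑<-+ : (n : ℕ) (f g : ℕ → ℚ) → ∑[ i < n ] (f i + g i) ≡ ∑< n f + ∑< n g
∑<-+ n f g = trans (sym (∑-upTo n _)) (trans (∑-+ (upTo n) f g) (cong₂ _+_ (∑-upTo n f) (∑-upTo n g)))

∑<-*ˡ : (n : ℕ) (c : ℚ) (f : ℕ → ℚ) → ∑[ i < n ] (c * f i) ≡ c * ∑< n f
∑<-*ˡ n c f = trans (sym (∑-upTo n _)) (trans (∑-*ˡ (upTo n) c f) (cong (c *_) (∑-upTo n f)))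

∑<-neg : (n : ℕ) (f : ℕ → ℚ) → ∑[ i < n ] (- f i) ≡ - ∑< n f
∑<-neg n f = trans (sym (∑-upTo n _)) (trans (∑-neg (upTo n) f) (cong -_ (∑-upTo n f)))

∑<-truncate : {K N : ℕ} (f : ℕ → ℚ) → K ≤ N → (∀ {i} → K ≤ i → f i ≡ 0ℚ) → ∑< N f ≡ ∑< K f
∑<-truncate {zero}  {N}     f _         f≡0 = ∑<-zero N (λ i → f≡0 z≤n)
∑<-truncate {suc K} {suc N} f (s≤s K≤N) f≡0 = cong (f 0 +_) (∑<-truncate (f ∘ suc) K≤N (f≡0 ∘ s≤s))

∑<-antidiagonal : (N : ℕ) (F : ℕ → ℕ → ℚ) →
  ∑[ n < N ] ∑[ e < suc n ] F e (n ∸ e) ≡ ∑[ e < N ] ∑[ j < N ∸ e ] F e j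
∑<-antidiagonal zero    F = refl
∑<-antidiagonal (suc N) F = begin
    (F 0 0 + 0ℚ) + ∑[ n < N ] (F 0 (suc n) + ∑[ e < suc n ] F (suc e) (n ∸ e))
  ≡⟨ cong₂ _+_ (ℚₚ.+-identityʳ (F 0 0)) (∑<-+ N _ _) ⟩
    F 0 0 + (∑[ n < N ] F 0 (suc n) + ∑[ n < N ] ∑[ e < suc n ] F (suc e) (n ∸ e))
  ≡⟨ sym (ℚₚ.+-assoc (F 0 0) _ _) ⟩
    (F 0 0 + ∑[ n < N ] F 0 (suc n)) + ∑[ n < N ] ∑[ e < suc n ] F (suc e) (n ∸ e)
  ≡⟨ cong (F 0 0 + ∑[ n < N ] F 0 (suc n) +_) (∑<-antidiagonal N (F ∘ suc)) ⟩
    (F 0 0 + ∑[ n < N ] F 0 (suc n)) + ∑[ e < N ] ∑[ j < N ∸ e ] F (suc e) j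
  ∎

𝟙 : Bool → ℚ
𝟙 true  = 1ℚ
𝟙 false = 0ℚ

𝟙-∧ : (x y : Bool) → 𝟙 (x ∧ y) ≡ 𝟙 x * 𝟙 y
𝟙-∧ true  y = sym (ℚₚ.*-identityˡ (𝟙 y))
𝟙-∧ false y = sym (ℚₚ.*-zeroˡ (𝟙 y))

≡ᵇ-sym : (a b : ℕ) → (a ≡ᵇ b) ≡ (b ≡ᵇ a)
≡ᵇ-sym zero    zero    = refl
≡ᵇ-sym zero    (suc b) = refl
≡ᵇ-sym (suc a) zero    = refl
≡ᵇ-sym (suc a) (suc b) = ≡ᵇ-sym a b

≡ᵇ-refl : (a : ℕ) → (a ≡ᵇ a) ≡ true
≡ᵇ-refl zero    = refl
≡ᵇ-refl (suc a) = ≡ᵇ-refl a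

≡ᵇ-complete : {a b : ℕ} → ¬ a ≡ b → (a ≡ᵇ b) ≡ false
≡ᵇ-complete {a} {b} a≢b with a ≡ᵇ b in eq
... | true  = ⊥-elim (a≢b (ℕₚ.≡ᵇ⇒≡ a b (subst T (sym eq) _)))
... | false = refl

infix 4 _==_

_==_ : Comp → Comp → Bool
[]      == []      = true
(a ∷ α) == (b ∷ β) = (a ≡ᵇ b) ∧ (α == β)
_       == _       = false

==-sym : (α β : Comp) → (α == β) ≡ (β == α)
==-sym []      []      = refl
==-sym []      (_ ∷ _) = refl
==-sym (_ ∷ _) []      = refl
==-sym (a ∷ α) (b ∷ β) = cong₂ _∧_ (≡ᵇ-sym a b) (==-sym α β)

==-refl : (α : Comp) → (α == α) ≡ true
==-refl []      = refl
==-refl (a ∷ α) rewrite ≡ᵇ-refl a = ==-refl α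

==-sound : (α β : Comp) → (α == β) ≡ true → α ≡ β
==-sound []      []      _ = refl
==-sound (a ∷ α) (b ∷ β) eq with a ≡ᵇ b in a≡ᵇb
... | true = cong₂ _∷_ (ℕₚ.≡ᵇ⇒≡ a b (subst T (sym a≡ᵇb) _)) (==-sound α β eq)

==-complete : (α β : Comp) → ¬ α ≡ β → (α == β) ≡ false
==-complete α β α≢β with α == β in eq
... | true  = ⊥-elim (α≢β (==-sound α β eq))
... | false = refl

mult : Comp → List Comp → ℚ
mult α L = ∑[ γ ∈ L ] 𝟙 (γ == α)

mult-map-∷ : (a b : ℕ) (β : Comp) (L : List Comp) → mult (b ∷ β) (map (a ∷_) L) ≡ 𝟙 (a ≡ᵇ b) * mult β L
mult-map-∷ a b β L = begin
  mult (b ∷ β) (map (a ∷_) L)              ≡⟨ ∑-map L (a ∷_) _ ⟩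
  ∑[ γ ∈ L ] 𝟙 ((a ≡ᵇ b) ∧ (γ == β))       ≡⟨ ∑-cong L (λ γ → 𝟙-∧ (a ≡ᵇ b) (γ == β)) ⟩
  ∑[ γ ∈ L ] (𝟙 (a ≡ᵇ b) * 𝟙 (γ == β))     ≡⟨ ∑-*ˡ L (𝟙 (a ≡ᵇ b)) _ ⟩
  𝟙 (a ≡ᵇ b) * mult β L                    ∎

mult-[]-map-∷ : (a : ℕ) (L : List Comp) → mult [] (map (a ∷_) L) ≡ 0ℚ
mult-[]-map-∷ a L = trans (∑-map L (a ∷_) _) (∑-zero L (λ _ → refl))

pairH-as-∑ : (α : Comp) (G : QSym) → pairH α G ≡ ∑ G (λ { (c , γ) → c * 𝟙 (γ == α) })
pairH-as-∑ α [] = refl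
pairH-as-∑ α ((c , γ) ∷ G) with γ ≟c α
... | yes refl = cong₂ _+_ (trans (sym (ℚₚ.*-identityʳ c)) (cong (λ b → c * 𝟙 b) (sym (==-refl γ)))) (pairH-as-∑ α G)
... | no γ≢α   = begin
  pairH α G                  ≡⟨ pairH-as-∑ α G ⟩
  ∑ G f                      ≡⟨ ℚₚ.+-identityˡ _ ⟨
  0ℚ + ∑ G f                 ≡⟨ cong (_+ ∑ G f) (ℚₚ.*-zeroʳ c) ⟨
  c * 𝟙 false + ∑ G f        ≡⟨ cong (λ b → c * 𝟙 b + ∑ G f) (==-complete γ α γ≢α) ⟨
  c * 𝟙 (γ == α) + ∑ G f     ∎
  where
  f : ℚ × Comp → ℚ
  f (c , γ) = c * 𝟙 (γ == α)

pairH-·M : (α β : Comp) (F : QSym) → pairH α (F ·M β) ≡ ∑ F (λ { (d , γ) → d * mult α (qsh γ β) })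
pairH-·M α β F = begin
  pairH α (F ·M β)                   ≡⟨ pairH-as-∑ α (F ·M β) ⟩
  ∑ (F ·M β) _                       ≡⟨ ∑-concatMap F _ _ ⟩
  _                                  ≡⟨ ∑-cong F (λ { (d , γ) → trans (∑-map (qsh γ β) (d ,_) _) (∑-*ˡ (qsh γ β) d _) }) ⟩
  ∑ F (λ { (d , γ) → d * mult α (qsh γ β) }) ∎

-- Quasi-shuffle duality

cons⁺ : ℕ → Comp → Comp
cons⁺ zero    β = β
cons⁺ (suc a) β = suc a ∷ β

consResidual : ℕ → ℕ → List Comp → List Comp
consResidual zero    a       L = map (cons⁺ a) L
consResidual (suc g) zero    L = []
consResidual (suc g) (suc a) L = consResidual g a L

-- qshDual γ α lists, with multiplicity, the β such that α occurs in qsh γ β: the first part a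
-- of α is either the first part of β, or the first part g of γ merged with a part a ∸ g of β
-- (with nothing taken from β when a = g).
qshDual : Comp → Comp → List Comp
qshDual []      α       = α ∷ []
qshDual (g ∷ γ) []      = []
qshDual (g ∷ γ) (a ∷ α) = map (a ∷_) (qshDual (g ∷ γ) α) ++ consResidual g a (qshDual γ α)

mult-consResidual : (g a b : ℕ) (β : Comp) (L : List Comp) →
  mult (suc b ∷ β) (consResidual g a L) ≡ 𝟙 (g ≡ᵇ a) * mult (suc b ∷ β) L + 𝟙 (g ℕ.+ suc b ≡ᵇ a) * mult β L
mult-consResidual zero zero b β L = begin
  mult (suc b ∷ β) (map id L)                       ≡⟨ ∑-map L id _ ⟩
  mult (suc b ∷ β) L                                ≡⟨ solve 2 (λ x y → x := con 1ℚ :* x :+ con 0ℚ :* y) refl _ (mult β L) ⟩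
  1ℚ * mult (suc b ∷ β) L + 0ℚ * mult β L           ∎
mult-consResidual zero (suc a) b β L = begin
  mult (suc b ∷ β) (map (suc a ∷_) L)               ≡⟨ mult-map-∷ (suc a) (suc b) β L ⟩
  𝟙 (a ≡ᵇ b) * mult β L                             ≡⟨ cong (λ x → 𝟙 x * mult β L) (≡ᵇ-sym a b) ⟩
  𝟙 (b ≡ᵇ a) * mult β L                             ≡⟨ solve 2 (λ x y → y := con 0ℚ :* x :+ y) refl (mult (suc b ∷ β) L) _ ⟩
  0ℚ * mult (suc b ∷ β) L + 𝟙 (b ≡ᵇ a) * mult β L   ∎
mult-consResidual (suc g) zero    b β L =
  solve 2 (λ x y → con 0ℚ := con 0ℚ :* x :+ con 0ℚ :* y) refl (mult (suc b ∷ β) L) (mult β L)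
mult-consResidual (suc g) (suc a) b β L = mult-consResidual g a b β L

mult-[]-consResidual : (g a : ℕ) (L : List Comp) → mult [] (consResidual g a L) ≡ 𝟙 (g ≡ᵇ a) * mult [] L
mult-[]-consResidual zero    zero    L = trans (∑-map L id _) (sym (ℚₚ.*-identityˡ _))
mult-[]-consResidual zero    (suc a) L = trans (mult-[]-map-∷ (suc a) L) (sym (ℚₚ.*-zeroˡ (mult [] L)))
mult-[]-consResidual (suc g) zero    L = sym (ℚₚ.*-zeroˡ (mult [] L))
mult-[]-consResidual (suc g) (suc a) L = mult-[]-consResidual g a L

mult-++ : (α : Comp) (L L′ : List Comp) → mult α (L ++ L′) ≡ mult α L + mult α L′
mult-++ α L L′ = ∑-++ L L′ _

mult-singleton : (α β : Comp) → mult α (β ∷ []) ≡ 𝟙 (β == α)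
mult-singleton α β = ℚₚ.+-identityʳ _

mult-qsh-∷ : (a g b : ℕ) (α γ β : Comp) →
  mult (a ∷ α) (qsh (g ∷ γ) (b ∷ β)) ≡
    𝟙 (g ≡ᵇ a) * mult α (qsh γ (b ∷ β)) + (𝟙 (b ≡ᵇ a) * mult α (qsh (g ∷ γ) β) + 𝟙 (g ℕ.+ b ≡ᵇ a) * mult α (qsh γ β))
mult-qsh-∷ a g b α γ β =
  trans (mult-++ (a ∷ α) (map (g ∷_) (qsh γ (b ∷ β))) _)
        (cong₂ _+_ (mult-map-∷ g a α (qsh γ (b ∷ β)))
                   (trans (mult-++ (a ∷ α) (map (b ∷_) (qsh (g ∷ γ) β)) _)
                          (cong₂ _+_ (mult-map-∷ b a α (qsh (g ∷ γ) β)) (mult-map-∷ (g ℕ.+ b) a α (qsh γ β)))))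

mult-qshDual-∷ : (g a b : ℕ) (γ α β : Comp) →
  mult (suc b ∷ β) (qshDual (g ∷ γ) (a ∷ α)) ≡
    𝟙 (a ≡ᵇ suc b) * mult β (qshDual (g ∷ γ) α)
      + (𝟙 (g ≡ᵇ a) * mult (suc b ∷ β) (qshDual γ α) + 𝟙 (g ℕ.+ suc b ≡ᵇ a) * mult β (qshDual γ α))
mult-qshDual-∷ g a b γ α β = begin
  mult (suc b ∷ β) (map (a ∷_) (qshDual (g ∷ γ) α) ++ consResidual g a (qshDual γ α))
    ≡⟨ mult-++ (suc b ∷ β) (map (a ∷_) (qshDual (g ∷ γ) α)) _ ⟩
  mult (suc b ∷ β) (map (a ∷_) (qshDual (g ∷ γ) α)) + mult (suc b ∷ β) (consResidual g a (qshDual γ α))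
    ≡⟨ cong₂ _+_ (mult-map-∷ a (suc b) β (qshDual (g ∷ γ) α)) (mult-consResidual g a b β (qshDual γ α)) ⟩
  𝟙 (a ≡ᵇ suc b) * mult β (qshDual (g ∷ γ) α)
    + (𝟙 (g ≡ᵇ a) * mult (suc b ∷ β) (qshDual γ α) + 𝟙 (g ℕ.+ suc b ≡ᵇ a) * mult β (qshDual γ α))
    ∎

mult-qsh≡mult-qshDual : (γ β α : Comp) → IsComp β → mult α (qsh γ β) ≡ mult β (qshDual γ α)
mult-qsh≡mult-qshDual [] β α _ = begin
  mult α (β ∷ [])   ≡⟨ mult-singleton α β ⟩
  𝟙 (β == α)        ≡⟨ cong 𝟙 (==-sym β α) ⟩
  𝟙 (α == β)        ≡⟨ mult-singleton β α ⟨
  mult β (α ∷ [])   ∎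
mult-qsh≡mult-qshDual (g ∷ γ) [] [] _ = refl
mult-qsh≡mult-qshDual (g ∷ γ) [] (a ∷ α) _ = begin
  mult (a ∷ α) ((g ∷ γ) ∷ [])                    ≡⟨ mult-singleton (a ∷ α) (g ∷ γ) ⟩
  𝟙 ((g ≡ᵇ a) ∧ (γ == α))                        ≡⟨ 𝟙-∧ (g ≡ᵇ a) (γ == α) ⟩
  𝟙 (g ≡ᵇ a) * 𝟙 (γ == α)                        ≡⟨ cong (𝟙 (g ≡ᵇ a) *_) γ-step ⟩
  𝟙 (g ≡ᵇ a) * mult [] (qshDual γ α)             ≡⟨ mult-[]-consResidual g a (qshDual γ α) ⟨
  R                                              ≡⟨ ℚₚ.+-identityˡ R ⟨
  0ℚ + R                                         ≡⟨ cong (_+ R) (mult-[]-map-∷ a (qshDual (g ∷ γ) α)) ⟨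
  mult [] (map (a ∷_) (qshDual (g ∷ γ) α)) + R   ≡⟨ mult-++ [] (map (a ∷_) (qshDual (g ∷ γ) α)) _ ⟨
  mult [] (qshDual (g ∷ γ) (a ∷ α))              ∎
  where
  R : ℚ
  R = mult [] (consResidual g a (qshDual γ α))
  qsh-[] : (γ : Comp) → qsh γ [] ≡ γ ∷ []
  qsh-[] []      = refl
  qsh-[] (_ ∷ _) = refl
  γ-step : 𝟙 (γ == α) ≡ mult [] (qshDual γ α)
  γ-step = trans (sym (mult-singleton α γ))
                 (trans (cong (mult α) (sym (qsh-[] γ))) (mult-qsh≡mult-qshDual γ [] α []))
mult-qsh≡mult-qshDual (g ∷ γ) (b ∷ β) [] _ =
  trans (mult-++ [] (map (g ∷_) (qsh γ (b ∷ β))) _)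
        (cong₂ _+_ (mult-[]-map-∷ g (qsh γ (b ∷ β)))
                   (trans (mult-++ [] (map (b ∷_) (qsh (g ∷ γ) β)) _)
                          (cong₂ _+_ (mult-[]-map-∷ b (qsh (g ∷ γ) β)) (mult-[]-map-∷ (g ℕ.+ b) (qsh γ β)))))
mult-qsh≡mult-qshDual (g ∷ γ) (suc b ∷ β) (a ∷ α) (_ ∷ β⁺) = begin
  mult (a ∷ α) (qsh (g ∷ γ) (suc b ∷ β))
    ≡⟨ mult-qsh-∷ a g (suc b) α γ β ⟩
  𝟙 (g ≡ᵇ a) * mult α (qsh γ (suc b ∷ β)) + (𝟙 (suc b ≡ᵇ a) * mult α (qsh (g ∷ γ) β) + 𝟙 (g ℕ.+ suc b ≡ᵇ a) * mult α (qsh γ β))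
    ≡⟨ cong₂ _+_ (cong (𝟙 (g ≡ᵇ a) *_) (mult-qsh≡mult-qshDual γ (suc b ∷ β) α (s≤s z≤n ∷ β⁺)))
                 (cong₂ _+_ (cong₂ _*_ (cong 𝟙 (≡ᵇ-sym (suc b) a)) (mult-qsh≡mult-qshDual (g ∷ γ) β α β⁺))
                            (cong (𝟙 (g ℕ.+ suc b ≡ᵇ a) *_) (mult-qsh≡mult-qshDual γ β α β⁺))) ⟩
  𝟙 (g ≡ᵇ a) * X + (𝟙 (a ≡ᵇ suc b) * Y + 𝟙 (g ℕ.+ suc b ≡ᵇ a) * Z)
    ≡⟨ solve 6 (λ p x q y r z → p :* x :+ (q :* y :+ r :* z) := q :* y :+ (p :* x :+ r :* z)) refl
               (𝟙 (g ≡ᵇ a)) X (𝟙 (a ≡ᵇ suc b)) Y (𝟙 (g ℕ.+ suc b ≡ᵇ a)) Z ⟩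
  𝟙 (a ≡ᵇ suc b) * Y + (𝟙 (g ≡ᵇ a) * X + 𝟙 (g ℕ.+ suc b ≡ᵇ a) * Z)
    ≡⟨ mult-qshDual-∷ g a b γ α β ⟨
  mult (suc b ∷ β) (qshDual (g ∷ γ) (a ∷ α))
    ∎
  where
  X Y Z : ℚ
  X = mult (suc b ∷ β) (qshDual γ α)
  Y = mult β (qshDual (g ∷ γ) α)
  Z = mult β (qshDual γ α)

concatMap⁺ : {A B : Set} {P : A → Set} {Q : B → Set} {f : A → List B} {xs : List A} →
             (∀ {x} → P x → All Q (f x)) → All P xs → All Q (concatMap f xs)
concatMap⁺ h = All.concat⁺ ∘ All.map⁺ ∘ All.map h

comps-isComp : (n : ℕ) → All IsComp (comps n)
comps-isComp zero          = [] ∷ []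
comps-isComp (suc zero)    = (s≤s z≤n ∷ []) ∷ []
comps-isComp (suc (suc n)) = concatMap⁺ (λ c⁺ → (s≤s z≤n ∷ c⁺) ∷ bumpHead-isComp c⁺ ∷ []) (comps-isComp (suc n))
  where
  bumpHead-isComp : {c : Comp} → IsComp c → IsComp (bumpHead c)
  bumpHead-isComp []       = []
  bumpHead-isComp (_ ∷ c⁺) = s≤s z≤n ∷ c⁺

comps-size : (n : ℕ) → All (λ γ → size γ ≡ n) (comps n)
comps-size zero          = refl ∷ []
comps-size (suc zero)    = refl ∷ []
comps-size (suc (suc n)) = concatMap⁺ step (comps-size (suc n))
  where
  step : {c : Comp} → size c ≡ suc n → All (λ γ → size γ ≡ suc (suc n)) ((1 ∷ c) ∷ bumpHead c ∷ [])
  step {a ∷ c} eq = cong suc eq ∷ cong suc eq ∷ []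

compsUpTo-isComp : (N : ℕ) → All IsComp (compsUpTo N)
compsUpTo-isComp N = concatMap⁺ (λ {n} _ → comps-isComp n) (All.all-upTo (suc N))

isCompositionOf : Comp → ℕ → Bool
isCompositionOf []          n       = n ≡ᵇ 0
isCompositionOf (zero ∷ _)  _       = false
isCompositionOf (suc a ∷ γ) zero    = false
isCompositionOf (suc a ∷ γ) (suc n) = isCompositionOf (cons⁺ a γ) n

isCompositionOf-isComp : {β : Comp} → IsComp β → (n : ℕ) → isCompositionOf β n ≡ (size β ≡ᵇ n)
isCompositionOf-isComp []                       n       = ≡ᵇ-sym n 0
isCompositionOf-isComp (s≤s z≤n ∷ β⁺)           zero    = refl
isCompositionOf-isComp {suc zero ∷ β}    (_ ∷ β⁺) (suc n) = isCompositionOf-isComp β⁺ n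
isCompositionOf-isComp {suc (suc a) ∷ β} (_ ∷ β⁺) (suc n) = isCompositionOf-isComp (s≤s z≤n ∷ β⁺) n

mult-comps-suc-suc : (n : ℕ) → (∀ β → mult β (comps (suc n)) ≡ 𝟙 (isCompositionOf β (suc n))) →
                     ∀ β → mult β (comps (suc (suc n))) ≡ 𝟙 (isCompositionOf β (suc (suc n)))
mult-comps-suc-suc n IH β = begin
  mult β (comps (suc (suc n)))
    ≡⟨ ∑-concatMap (comps (suc n)) _ _ ⟩
  ∑[ c ∈ comps (suc n) ] (𝟙 (1 ∷ c == β) + (𝟙 (bumpHead c == β) + 0ℚ))
    ≡⟨ ∑-cong (comps (suc n)) (λ c → cong (𝟙 (1 ∷ c == β) +_) (ℚₚ.+-identityʳ _)) ⟩
  ∑[ c ∈ comps (suc n) ] (𝟙 (1 ∷ c == β) + 𝟙 (bumpHead c == β))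
    ≡⟨ ∑-+ (comps (suc n)) _ _ ⟩
  mult⁻ β + ∑[ c ∈ comps (suc n) ] 𝟙 (bumpHead c == β)
    ≡⟨ step β ⟩
  𝟙 (isCompositionOf β (suc (suc n)))
    ∎
  where
  mult⁻ : Comp → ℚ
  mult⁻ β = ∑[ c ∈ comps (suc n) ] 𝟙 (1 ∷ c == β)
  bumpHead-==-suc : (c : Comp) (a : ℕ) (γ : Comp) → (bumpHead c == suc a ∷ γ) ≡ (c == a ∷ γ)
  bumpHead-==-suc []      a γ = refl
  bumpHead-==-suc (_ ∷ _) a γ = refl
  bumpHead-==-[] : (c : Comp) → (bumpHead c == []) ≡ (c == [])
  bumpHead-==-[] []      = refl
  bumpHead-==-[] (_ ∷ _) = refl
  bumpHead-==-zero : (c : Comp) (γ : Comp) → (bumpHead c == 0 ∷ γ) ≡ false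
  bumpHead-==-zero []      γ = refl
  bumpHead-==-zero (_ ∷ _) γ = refl
  step : (β : Comp) → mult⁻ β + ∑[ c ∈ comps (suc n) ] 𝟙 (bumpHead c == β) ≡ 𝟙 (isCompositionOf β (suc (suc n)))
  step [] = begin
    mult⁻ [] + ∑[ c ∈ comps (suc n) ] 𝟙 (bumpHead c == [])
      ≡⟨ cong (_+ ∑[ c ∈ comps (suc n) ] 𝟙 (bumpHead c == [])) (∑-zero (comps (suc n)) (λ _ → refl)) ⟩
    0ℚ + ∑[ c ∈ comps (suc n) ] 𝟙 (bumpHead c == [])
      ≡⟨ ℚₚ.+-identityˡ _ ⟩
    ∑[ c ∈ comps (suc n) ] 𝟙 (bumpHead c == [])
      ≡⟨ ∑-cong (comps (suc n)) (cong 𝟙 ∘ bumpHead-==-[]) ⟩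
    mult [] (comps (suc n))
      ≡⟨ IH [] ⟩
    0ℚ
      ∎
  step (zero ∷ γ) = trans (cong₂ _+_ (∑-zero (comps (suc n)) (λ _ → refl))
                                     (∑-zero (comps (suc n)) (λ c → cong 𝟙 (bumpHead-==-zero c γ))))
                          (ℚₚ.+-identityˡ 0ℚ)
  step (suc a ∷ γ) = begin
    ∑[ c ∈ comps (suc n) ] 𝟙 ((0 ≡ᵇ a) ∧ (c == γ)) + ∑[ c ∈ comps (suc n) ] 𝟙 (bumpHead c == suc a ∷ γ)
      ≡⟨ cong₂ _+_ (trans (sym (∑-map (comps (suc n)) (1 ∷_) _)) (mult-map-∷ 1 (suc a) γ (comps (suc n))))
                   (∑-cong (comps (suc n)) (λ c → cong 𝟙 (bumpHead-==-suc c a γ))) ⟩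
    𝟙 (0 ≡ᵇ a) * mult γ (comps (suc n)) + mult (a ∷ γ) (comps (suc n))
      ≡⟨ cong₂ (λ x y → 𝟙 (0 ≡ᵇ a) * x + y) (IH γ) (IH (a ∷ γ)) ⟩
    𝟙 (0 ≡ᵇ a) * 𝟙 (isCompositionOf γ (suc n)) + 𝟙 (isCompositionOf (a ∷ γ) (suc n))
      ≡⟨ head-cases a ⟩
    𝟙 (isCompositionOf (cons⁺ a γ) (suc n))
      ∎
    where
    head-cases : (a : ℕ) → 𝟙 (0 ≡ᵇ a) * 𝟙 (isCompositionOf γ (suc n)) + 𝟙 (isCompositionOf (a ∷ γ) (suc n))
                           ≡ 𝟙 (isCompositionOf (cons⁺ a γ) (suc n))
    head-cases zero    = trans (ℚₚ.+-identityʳ _) (ℚₚ.*-identityˡ _)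
    head-cases (suc a) = trans (cong (_+ 𝟙 (isCompositionOf (suc a ∷ γ) (suc n))) (ℚₚ.*-zeroˡ (𝟙 (isCompositionOf γ (suc n)))))
                               (ℚₚ.+-identityˡ _)

mult-comps : (β : Comp) (n : ℕ) → mult β (comps n) ≡ 𝟙 (isCompositionOf β n)
mult-comps []                zero       = refl
mult-comps (zero ∷ γ)        zero       = refl
mult-comps (suc a ∷ γ)       zero       = refl
mult-comps []                (suc zero) = refl
mult-comps (zero ∷ γ)        (suc zero) = refl
mult-comps (suc zero ∷ γ)    (suc zero) = trans (ℚₚ.+-identityʳ _) (cong 𝟙 ([]== γ))
  where
  []== : (γ : Comp) → ([] == γ) ≡ isCompositionOf γ 0
  []== []          = refl
  []== (zero ∷ _)  = refl
  []== (suc _ ∷ _) = refl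
mult-comps (suc (suc a) ∷ γ) (suc zero) = refl
mult-comps β (suc (suc n)) = mult-comps-suc-suc n (λ β → mult-comps β (suc n)) β

∑<-𝟙-≡ᵇ : {s N : ℕ} → s ≤ N → ∑[ n < suc N ] 𝟙 (s ≡ᵇ n) ≡ 1ℚ
∑<-𝟙-≡ᵇ {zero}  {N}     _         = trans (cong (1ℚ +_) (∑<-zero N (λ _ → refl))) (ℚₚ.+-identityʳ 1ℚ)
∑<-𝟙-≡ᵇ {suc s} {suc N} (s≤s s≤N) = trans (ℚₚ.+-identityˡ _) (∑<-𝟙-≡ᵇ s≤N)

mult-compsUpTo : {β : Comp} → IsComp β → {N : ℕ} → size β ≤ N → mult β (compsUpTo N) ≡ 1ℚ
mult-compsUpTo {β} β⁺ {N} β≤N = begin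
  mult β (compsUpTo N)                            ≡⟨ ∑-concatMap (upTo (suc N)) comps (λ γ → 𝟙 (γ == β)) ⟩
  ∑[ n ∈ upTo (suc N) ] mult β (comps n)          ≡⟨ ∑-upTo (suc N) (λ n → mult β (comps n)) ⟩
  ∑[ n < suc N ] mult β (comps n)                 ≡⟨ ∑<-cong (suc N) (λ n → mult-comps β n) ⟩
  ∑[ n < suc N ] 𝟙 (isCompositionOf β n)          ≡⟨ ∑<-cong (suc N) (cong 𝟙 ∘ isCompositionOf-isComp β⁺) ⟩
  ∑[ n < suc N ] 𝟙 (size β ≡ᵇ n)                  ≡⟨ ∑<-𝟙-≡ᵇ β≤N ⟩
  1ℚ                                              ∎

qshDual-isComp : (γ : Comp) {α : Comp} → IsComp α → All IsComp (qshDual γ α)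
qshDual-isComp []      α⁺        = α⁺ ∷ []
qshDual-isComp (g ∷ γ) []        = []
qshDual-isComp (g ∷ γ) (a⁺ ∷ α⁺) =
  All.++⁺ (All.map⁺ (All.map (a⁺ ∷_) (qshDual-isComp (g ∷ γ) α⁺))) (consResidual-isComp g _ (qshDual-isComp γ α⁺))
  where
  cons⁺-isComp : (a : ℕ) {β : Comp} → IsComp β → IsComp (cons⁺ a β)
  cons⁺-isComp zero    β⁺ = β⁺
  cons⁺-isComp (suc a) β⁺ = s≤s z≤n ∷ β⁺
  consResidual-isComp : (g a : ℕ) {L : List Comp} → All IsComp L → All IsComp (consResidual g a L)
  consResidual-isComp zero    a       L⁺ = All.map⁺ (All.map (cons⁺-isComp a) L⁺)
  consResidual-isComp (suc g) zero    L⁺ = []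
  consResidual-isComp (suc g) (suc a) L⁺ = consResidual-isComp g a L⁺

qshDual-size≤ : (γ α : Comp) → All (λ β → size β ≤ size α) (qshDual γ α)
qshDual-size≤ []      α       = ℕₚ.≤-refl ∷ []
qshDual-size≤ (g ∷ γ) []      = []
qshDual-size≤ (g ∷ γ) (a ∷ α) =
  All.++⁺ (All.map⁺ (All.map (ℕₚ.+-monoʳ-≤ a) (qshDual-size≤ (g ∷ γ) α))) (consResidual-size≤ g a (qshDual-size≤ γ α))
  where
  consResidual-size≤ : (g a : ℕ) {s : ℕ} {L : List Comp} →
                       All (λ β → size β ≤ s) L → All (λ β → size β ≤ a ℕ.+ s) (consResidual g a L)
  consResidual-size≤ zero    zero    L≤ = All.map⁺ L≤
  consResidual-size≤ zero    (suc a) L≤ = All.map⁺ (All.map (s≤s ∘ ℕₚ.+-monoʳ-≤ a) L≤)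
  consResidual-size≤ (suc g) zero    L≤ = []
  consResidual-size≤ (suc g) (suc a) L≤ = All.map ℕₚ.m≤n⇒m≤1+n (consResidual-size≤ g a L≤)

consResidual-< : {g a : ℕ} (L : List Comp) → a < g → consResidual g a L ≡ []
consResidual-< {suc g} {zero}  L _         = refl
consResidual-< {suc g} {suc a} L (s≤s a<g) = consResidual-< L a<g

qshDual-vanishes : (γ α : Comp) → size α < size γ → qshDual γ α ≡ []
qshDual-vanishes (g ∷ γ) []      _ = refl
qshDual-vanishes (g ∷ γ) (a ∷ α) α<γ =
  cong₂ _++_ (cong (map (a ∷_)) (qshDual-vanishes (g ∷ γ) α (ℕₚ.≤-<-trans (ℕₚ.m≤n+m (size α) a) α<γ))) residual-vanishes
  where
  consResidual-[] : (g a : ℕ) → consResidual g a [] ≡ []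
  consResidual-[] zero    a       = refl
  consResidual-[] (suc g) zero    = refl
  consResidual-[] (suc g) (suc a) = consResidual-[] g a
  residual-vanishes : consResidual g a (qshDual γ α) ≡ []
  residual-vanishes with g ℕ.≤? a
  ... | no g≰a = consResidual-< _ (ℕₚ.≰⇒> g≰a)
  ... | yes g≤a with size α ℕ.<? size γ
  ...   | yes α<γ′ = trans (cong (consResidual g a) (qshDual-vanishes γ α α<γ′)) (consResidual-[] g a)
  ...   | no α≮γ′  = ⊥-elim (ℕₚ.<⇒≱ α<γ (ℕₚ.+-mono-≤ g≤a (ℕₚ.≮⇒≥ α≮γ′)))

-- ⟨F^⊥ H_α, V⟩ for the linear form V given on the basis H_β
perpᵀ : QSym → Comp → (Comp → ℚ) → ℚ
perpᵀ F α V = ∑[ β ∈ compsUpTo (size α) ] (pairH α (F ·M β) * V β)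

∑-mult-qsh : (γ : Comp) {α : Comp} (V : Comp → ℚ) → IsComp α →
             ∑[ β ∈ compsUpTo (size α) ] (mult α (qsh γ β) * V β) ≡ ∑ (qshDual γ α) V
∑-mult-qsh γ {α} V α⁺ = begin
  ∑[ β ∈ B ] (mult α (qsh γ β) * V β)
    ≡⟨ ∑-congᴬ (compsUpTo-isComp (size α)) (λ {β} β⁺ → cong (_* V β) (mult-qsh≡mult-qshDual γ β α β⁺)) ⟩
  ∑[ β ∈ B ] (mult β D * V β)
    ≡⟨ ∑-cong B (λ β → ∑-*ʳ D (λ δ → 𝟙 (δ == β)) (V β)) ⟩
  ∑[ β ∈ B ] ∑[ δ ∈ D ] (𝟙 (δ == β) * V β)
    ≡⟨ ∑-swap B D _ ⟩
  ∑[ δ ∈ D ] ∑[ β ∈ B ] (𝟙 (δ == β) * V β)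
    ≡⟨ ∑-cong D (λ δ → trans (∑-cong B (𝟙-== δ)) (sym (∑-*ʳ B (λ β → 𝟙 (β == δ)) (V δ)))) ⟩
  ∑[ δ ∈ D ] (mult δ B * V δ)
    ≡⟨ ∑-congᴬ (All.zip (qshDual-isComp γ α⁺ , qshDual-size≤ γ α))
               (λ { {δ} (δ⁺ , δ≤α) → trans (cong (_* V δ) (mult-compsUpTo δ⁺ δ≤α)) (ℚₚ.*-identityˡ (V δ)) }) ⟩
  ∑ D V
    ∎
  where
  B D : List Comp
  B = compsUpTo (size α)
  D = qshDual γ α
  𝟙-== : (δ β : Comp) → 𝟙 (δ == β) * V β ≡ 𝟙 (β == δ) * V δ
  𝟙-== δ β with δ == β in eq
  ... | true  rewrite ==-sound δ β eq | ==-refl β = refl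
  ... | false rewrite ==-sym β δ | eq = trans (ℚₚ.*-zeroˡ (V β)) (sym (ℚₚ.*-zeroˡ (V δ)))

perpᵀ-qshDual : (F : QSym) {α : Comp} (V : Comp → ℚ) → IsComp α →
                perpᵀ F α V ≡ ∑ F (λ { (d , γ) → d * ∑ (qshDual γ α) V })
perpᵀ-qshDual F {α} V α⁺ = begin
  perpᵀ F α V
    ≡⟨ ∑-cong B (λ β → cong (_* V β) (pairH-·M α β F)) ⟩
  ∑[ β ∈ B ] (∑ F (λ { (d , γ) → d * mult α (qsh γ β) }) * V β)
    ≡⟨ ∑-cong B (λ β → trans (∑-*ʳ F _ (V β)) (∑-cong F (λ { (d , γ) → ℚₚ.*-assoc d (mult α (qsh γ β)) (V β) }))) ⟩
  ∑[ β ∈ B ] ∑ F (λ { (d , γ) → d * (mult α (qsh γ β) * V β) })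
    ≡⟨ ∑-swap B F _ ⟩
  ∑ F (λ { (d , γ) → ∑[ β ∈ B ] (d * (mult α (qsh γ β) * V β)) })
    ≡⟨ ∑-cong F (λ { (d , γ) → trans (∑-*ˡ B d _) (cong (d *_) (∑-mult-qsh γ V α⁺)) }) ⟩
  ∑ F (λ { (d , γ) → d * ∑ (qshDual γ α) V })
    ∎
  where
  B : List Comp
  B = compsUpTo (size α)

perpᵀ-F1n : (i : ℕ) {α : Comp} (V : Comp → ℚ) → IsComp α → perpᵀ (F1n i) α V ≡ ∑ (qshDual (replicate i 1) α) V
perpᵀ-F1n i V α⁺ = trans (perpᵀ-qshDual (F1n i) V α⁺) (trans (ℚₚ.+-identityʳ _) (ℚₚ.*-identityˡ _))

perpᵀ-Fn : (j : ℕ) {α : Comp} (V : Comp → ℚ) → IsComp α →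
           perpᵀ (Fn j) α V ≡ ∑[ γ ∈ comps j ] ∑ (qshDual γ α) V
perpᵀ-Fn j V α⁺ = trans (perpᵀ-qshDual (Fn j) V α⁺)
                        (trans (∑-map (comps j) (1ℚ ,_) _) (∑-cong (comps j) (λ γ → ℚₚ.*-identityˡ _)))

-- Linear forms on ℚ[q] ⊗ NSym, given by their values on the basis q^k H_β.
Weight : Set
Weight = ℕ → Comp → ℚ

⟪_,_⟫ₜ : Term → Weight → ℚ
⟪ (c , k , β) , W ⟫ₜ = c * W k β

⟪_,_⟫ : Elem → Weight → ℚ
⟪ x , W ⟫ = ∑[ t ∈ x ] ⟪ t , W ⟫ₜ

shift : ℕ → Weight → Weight
shift s W k = W (s ℕ.+ k)

pairing-scale : (c : ℚ) (s : ℕ) (x : Elem) (W : Weight) → ⟪ scale c s x , W ⟫ ≡ c * ⟪ x , shift s W ⟫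
pairing-scale c s x W = trans (∑-map x _ ⟪_, W ⟫ₜ)
  (trans (∑-cong x (λ { (d , j , α) → ℚₚ.*-assoc c d (W (s ℕ.+ j) α) })) (∑-*ˡ x c _))

Hmulᵀ : ℤ → Weight → Weight
Hmulᵀ (ℤ.+ zero)  W     = W
Hmulᵀ (ℤ.+ suc j) W k β = W k (suc j ∷ β)
Hmulᵀ -[1+ _ ]    W k β = 0ℚ

pairing-Hmul : (n : ℤ) (x : Elem) (W : Weight) → ⟪ Hmul n x , W ⟫ ≡ ⟪ x , Hmulᵀ n W ⟫
pairing-Hmul (ℤ.+ zero)  x W = refl
pairing-Hmul (ℤ.+ suc j) x W = ∑-map x _ ⟪_, W ⟫ₜ
pairing-Hmul -[1+ _ ]    x W = sym (∑-zero x (λ { (c , k , α) → ℚₚ.*-zeroʳ c }))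

pairing-perp : (F : QSym) (c : ℚ) (k : ℕ) (α : Comp) (W : Weight) →
               ⟪ perp F ((c , k , α) ∷ []) , W ⟫ ≡ c * perpᵀ F α (W k)
pairing-perp F c k α W = begin
  ⟪ L ++ [] , W ⟫                                          ≡⟨ cong ⟪_, W ⟫ (Listₚ.++-identityʳ L) ⟩
  ⟪ L , W ⟫                                                ≡⟨ ∑-map B (λ β → (c * pairH α (F ·M β) , k , β)) ⟪_, W ⟫ₜ ⟩
  ∑[ β ∈ B ] ((c * pairH α (F ·M β)) * W k β)              ≡⟨ ∑-cong B (λ β → ℚₚ.*-assoc c (pairH α (F ·M β)) (W k β)) ⟩
  ∑[ β ∈ B ] (c * (pairH α (F ·M β) * W k β))              ≡⟨ ∑-*ˡ B c _ ⟩
  c * perpᵀ F α (W k)                                      ∎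
  where
  B : List Comp
  B = compsUpTo (size α)
  L : Elem
  L = map (λ β → (c * pairH α (F ·M β) , k , β)) B

sumDegᵀ : (ℕ → ℚ) → (ℕ → ℕ) → (ℕ → QSym) → (ℕ → Weight → Weight) → Weight → Weight
sumDegᵀ c e F Opᵀ W k α = ∑[ i < suc (size α) ] (c i * perpᵀ (F i) α (Opᵀ i (shift (e i) W) k))

pairing-sumDeg : (c : ℕ → ℚ) (e : ℕ → ℕ) (F : ℕ → QSym) (Op : ℕ → Elem → Elem) (Opᵀ : ℕ → Weight → Weight) →
  (∀ i x W → ⟪ Op i x , W ⟫ ≡ ⟪ x , Opᵀ i W ⟫) →
  ∀ x W → ⟪ sumDeg (λ i t → scale (c i) (e i) (Op i (perp (F i) t))) x , W ⟫ ≡ ⟪ x , sumDegᵀ c e F Opᵀ W ⟫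
pairing-sumDeg c e F Op Opᵀ pairing-Op x W =
  trans (∑-concatMap x _ ⟪_, W ⟫ₜ) (∑-cong x (λ { (c′ , k , α) → term c′ k α }))
  where
  summand : ℕ → Elem → Elem
  summand i t = scale (c i) (e i) (Op i (perp (F i) t))
  term : (c′ : ℚ) (k : ℕ) (α : Comp) →
         ⟪ concatMap (λ i → summand i ((c′ , k , α) ∷ [])) (upTo (suc (size α))) , W ⟫ ≡ c′ * sumDegᵀ c e F Opᵀ W k α
  term c′ k α = begin
    ⟪ concatMap (λ i → summand i ((c′ , k , α) ∷ [])) (upTo (suc (size α))) , W ⟫
      ≡⟨ ∑-concatMap (upTo (suc (size α))) (λ i → summand i ((c′ , k , α) ∷ [])) ⟪_, W ⟫ₜ ⟩
    ∑[ i ∈ upTo (suc (size α)) ] ⟪ summand i ((c′ , k , α) ∷ []) , W ⟫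
      ≡⟨ ∑-upTo (suc (size α)) (λ i → ⟪ summand i ((c′ , k , α) ∷ []) , W ⟫) ⟩
    ∑[ i < suc (size α) ] ⟪ summand i ((c′ , k , α) ∷ []) , W ⟫
      ≡⟨ ∑<-cong (suc (size α)) summand-pairing ⟩
    ∑[ i < suc (size α) ] (c′ * (c i * P i))
      ≡⟨ ∑<-*ˡ (suc (size α)) c′ (λ i → c i * P i) ⟩
    c′ * sumDegᵀ c e F Opᵀ W k α
      ∎
    where
    P : ℕ → ℚ
    P i = perpᵀ (F i) α (Opᵀ i (shift (e i) W) k)
    summand-pairing : ∀ i → ⟪ summand i ((c′ , k , α) ∷ []) , W ⟫ ≡ c′ * (c i * P i)
    summand-pairing i = begin
      ⟪ summand i ((c′ , k , α) ∷ []) , W ⟫                   ≡⟨ pairing-scale (c i) (e i) (Op i (perp (F i) ((c′ , k , α) ∷ []))) W ⟩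
      c i * ⟪ Op i (perp (F i) ((c′ , k , α) ∷ [])) , shift (e i) W ⟫
                                                             ≡⟨ cong (c i *_) (pairing-Op i _ (shift (e i) W)) ⟩
      c i * ⟪ perp (F i) ((c′ , k , α) ∷ []) , Opᵀ i (shift (e i) W) ⟫
                                                             ≡⟨ cong (c i *_) (pairing-perp (F i) c′ k α _) ⟩
      c i * (c′ * P i)                                       ≡⟨ solve 3 (λ x y z → x :* (y :* z) := y :* (x :* z)) refl (c i) c′ (P i) ⟩
      c′ * (c i * P i)                                       ∎

𝔹ᵀ : ℤ → Weight → Weight
𝔹ᵀ m = sumDegᵀ sign (λ _ → 0) F1n (λ i → Hmulᵀ (m ℤ.+ ℤ.+ i))

pairing-𝔹 : (m : ℤ) (x : Elem) (W : Weight) → ⟪ 𝔹 m x , W ⟫ ≡ ⟪ x , 𝔹ᵀ m W ⟫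
pairing-𝔹 m = pairing-sumDeg sign (λ _ → 0) F1n (λ i → Hmul (m ℤ.+ ℤ.+ i)) _ (λ i → pairing-Hmul (m ℤ.+ ℤ.+ i))

𝔹̃ᵀ : ℤ → Weight → Weight
𝔹̃ᵀ m = sumDegᵀ (λ _ → 1ℚ) id Fn (λ j → 𝔹ᵀ (m ℤ.+ ℤ.+ j))

pairing-𝔹̃ : (m : ℤ) (x : Elem) (W : Weight) → ⟪ 𝔹̃ m x , W ⟫ ≡ ⟪ x , 𝔹̃ᵀ m W ⟫
pairing-𝔹̃ m = pairing-sumDeg (λ _ → 1ℚ) id Fn (λ j → 𝔹 (m ℤ.+ ℤ.+ j)) _ (λ j → pairing-𝔹 (m ℤ.+ ℤ.+ j))

RHSᵀ : ℤ → Weight → Weight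
RHSᵀ m = sumDegᵀ sign id F1n (λ i → 𝔹̃ᵀ (m ℤ.+ ℤ.+ i))

pairing-RHS : (m : ℤ) (x : Elem) (W : Weight) → ⟪ RHS m x , W ⟫ ≡ ⟪ x , RHSᵀ m W ⟫
pairing-RHS m = pairing-sumDeg sign id F1n (λ i → 𝔹̃ (m ℤ.+ ℤ.+ i)) _ (λ i → pairing-𝔹̃ (m ℤ.+ ℤ.+ i))

δ : ℕ → Comp → Weight
δ K Γ k β = 𝟙 ((k ≡ᵇ K) ∧ (β == Γ))

drop-zero-term : {c y z : ℚ} → z ≡ y → z ≡ c * 0ℚ + y
drop-zero-term {c} {y} z≡y = trans z≡y (sym (trans (cong (_+ y) (ℚₚ.*-zeroʳ c)) (ℚₚ.+-identityˡ y)))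

coeff-as-pairing : (K : ℕ) (Γ : Comp) (x : Elem) → coeff K Γ x ≡ ⟪ x , δ K Γ ⟫
coeff-as-pairing K Γ [] = refl
coeff-as-pairing K Γ ((c , j , α) ∷ x) with j ℕ.≟ K | α ≟c Γ
... | yes refl | yes refl rewrite ≡ᵇ-refl j | ==-refl α = cong₂ _+_ (sym (ℚₚ.*-identityʳ c)) (coeff-as-pairing j α x)
... | no j≢K   | _        rewrite ≡ᵇ-complete j≢K = drop-zero-term {c} (coeff-as-pairing K Γ x)
... | yes refl | no α≢Γ   rewrite ==-complete α Γ α≢Γ | ∧-zeroʳ (j ≡ᵇ j) = drop-zero-term {c} (coeff-as-pairing j Γ x)

-- Σ_{i+j=n} (-1)^i e_i h_j = δ_{n0}

-- hSum β Ψ = Σ_j ⟨h_j^⊥ H_β, Ψ j⟩ and eSum α G = Σ_i (-1)^i ⟨e_i^⊥ H_α, G i⟩ (perpᵀ-Fn, perpᵀ-F1n);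
-- the summands vanish beyond the bounds used.
hSumUpTo : ℕ → Comp → (ℕ → Comp → ℚ) → ℚ
hSumUpTo N β Ψ = ∑[ j < N ] ∑[ γ ∈ comps j ] ∑ (qshDual γ β) (Ψ j)

hSum : Comp → (ℕ → Comp → ℚ) → ℚ
hSum β = hSumUpTo (suc (size β)) β

hSumUpTo-truncate : {N : ℕ} (β : Comp) (Ψ : ℕ → Comp → ℚ) → suc (size β) ≤ N → hSumUpTo N β Ψ ≡ hSum β Ψ
hSumUpTo-truncate β Ψ β<N = ∑<-truncate _ β<N vanish
  where
  vanish : ∀ {j} → suc (size β) ≤ j → ∑[ γ ∈ comps j ] ∑ (qshDual γ β) (Ψ j) ≡ 0ℚ
  vanish {j} β<j = trans
    (∑-congᴬ (comps-size j) (λ {γ} γ≡j → cong (λ L → ∑ L (Ψ j)) (qshDual-vanishes γ β (subst (size β <_) (sym γ≡j) β<j))))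
    (∑-zero (comps j) (λ _ → refl))

hSum-cong : (β : Comp) {Ψ Ψ′ : ℕ → Comp → ℚ} → (∀ j δ → Ψ j δ ≡ Ψ′ j δ) → hSum β Ψ ≡ hSum β Ψ′
hSum-cong β Ψ≡Ψ′ = ∑<-cong (suc (size β)) (λ j → ∑-cong (comps j) (λ γ → ∑-cong (qshDual γ β) (Ψ≡Ψ′ j)))

∑-comps-suc : (n : ℕ) (f : Comp → ℚ) →
              ∑ (comps (suc n)) f ≡ ∑[ e < suc n ] ∑[ γ ∈ comps (n ∸ e) ] f (suc e ∷ γ)
∑-comps-suc zero    f = cong (_+ 0ℚ) (sym (ℚₚ.+-identityʳ (f (1 ∷ []))))
∑-comps-suc (suc n) f = begin
  ∑ (comps (suc (suc n))) f
    ≡⟨ ∑-concatMap (comps (suc n)) (λ c → (1 ∷ c) ∷ bumpHead c ∷ []) f ⟩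
  ∑[ c ∈ comps (suc n) ] (f (1 ∷ c) + (f (bumpHead c) + 0ℚ))
    ≡⟨ ∑-cong (comps (suc n)) (λ c → cong (f (1 ∷ c) +_) (ℚₚ.+-identityʳ _)) ⟩
  ∑[ c ∈ comps (suc n) ] (f (1 ∷ c) + f (bumpHead c))
    ≡⟨ ∑-+ (comps (suc n)) _ _ ⟩
  ∑[ c ∈ comps (suc n) ] f (1 ∷ c) + ∑[ c ∈ comps (suc n) ] f (bumpHead c)
    ≡⟨ cong (∑[ c ∈ comps (suc n) ] f (1 ∷ c) +_) (∑-comps-suc n (f ∘ bumpHead)) ⟩
  ∑[ c ∈ comps (suc n) ] f (1 ∷ c) + ∑[ e < suc n ] ∑[ γ ∈ comps (n ∸ e) ] f (suc (suc e) ∷ γ)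
    ∎

residual : Comp → ℕ → Comp → (Comp → ℚ) → ℚ
residual []      b β F = 0ℚ
residual (g ∷ γ) b β F = ∑ (consResidual g b (qshDual γ β)) F

∑-qshDual-∷ : (γ : Comp) (b : ℕ) (β : Comp) (F : Comp → ℚ) →
              ∑ (qshDual γ (b ∷ β)) F ≡ ∑[ δ ∈ qshDual γ β ] F (b ∷ δ) + residual γ b β F
∑-qshDual-∷ []      b β F = sym (ℚₚ.+-identityʳ _)
∑-qshDual-∷ (g ∷ γ) b β F = trans (∑-++ (map (b ∷_) (qshDual (g ∷ γ) β)) _ F)
  (cong (_+ residual (g ∷ γ) b β F) (∑-map (qshDual (g ∷ γ) β) (b ∷_) F))

∑-consResidual : {e b : ℕ} → e ≤ b → (L : List Comp) (F : Comp → ℚ) →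
                 ∑ (consResidual e b L) F ≡ ∑[ δ ∈ L ] F (cons⁺ (b ∸ e) δ)
∑-consResidual {b = b} z≤n L F = ∑-map L (cons⁺ b) F
∑-consResidual (s≤s e≤b)   L F = ∑-consResidual e≤b L F

hSum-residual : (b : ℕ) (β : Comp) (Ψ : ℕ → Comp → ℚ) →
  ∑[ j < suc (suc (b ℕ.+ size β)) ] ∑[ γ ∈ comps j ] residual γ (suc b) β (Ψ j) ≡
  ∑[ e < suc b ] hSum β (λ j δ → Ψ (j ℕ.+ suc e) (cons⁺ (b ∸ e) δ))
hSum-residual b β Ψ = begin
  (0ℚ + 0ℚ) + ∑[ n < M ] ∑[ γ ∈ comps (suc n) ] residual γ (suc b) β (Ψ (suc n))
    ≡⟨ cong₂ _+_ (ℚₚ.+-identityʳ 0ℚ) (∑<-cong M (λ n → ∑-comps-suc n (λ γ → residual γ (suc b) β (Ψ (suc n))))) ⟩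
  0ℚ + ∑[ n < M ] ∑[ e < suc n ] ∑[ γ ∈ comps (n ∸ e) ] ∑ (consResidual e b (qshDual γ β)) (Ψ (suc n))
    ≡⟨ ℚₚ.+-identityˡ _ ⟩
  ∑[ n < M ] ∑[ e < suc n ] ∑[ γ ∈ comps (n ∸ e) ] ∑ (consResidual e b (qshDual γ β)) (Ψ (suc n))
    ≡⟨ ∑<-cong M (λ n → ∑<-cong< (suc n) (λ {e} e<n → cong (R e (n ∸ e) ∘ suc) (sym (ℕₚ.m+[n∸m]≡n (ℕₚ.≤-pred e<n))))) ⟩
  ∑[ n < M ] ∑[ e < suc n ] R e (n ∸ e) (suc (e ℕ.+ (n ∸ e)))
    ≡⟨ ∑<-antidiagonal M (λ e j → R e j (suc (e ℕ.+ j))) ⟩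
  ∑[ e < M ] ∑[ j < M ∸ e ] R e j (suc (e ℕ.+ j))
    ≡⟨ ∑<-truncate (λ e → ∑[ j < M ∸ e ] R e j (suc (e ℕ.+ j))) (s≤s (ℕₚ.m≤m+n b (size β)))
                    (λ {e} b<e → ∑<-zero (M ∸ e) (residual-vanishes b<e)) ⟩
  ∑[ e < suc b ] ∑[ j < M ∸ e ] R e j (suc (e ℕ.+ j))
    ≡⟨ ∑<-cong< (suc b) (λ e<b → residual-hSum (ℕₚ.≤-pred e<b)) ⟩
  ∑[ e < suc b ] hSum β (λ j δ → Ψ (j ℕ.+ suc e) (cons⁺ (b ∸ e) δ))
    ∎
  where
  M : ℕ
  M = suc (b ℕ.+ size β)
  R : ℕ → ℕ → ℕ → ℚ
  R e j n = ∑[ γ ∈ comps j ] ∑ (consResidual e b (qshDual γ β)) (Ψ n)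
  residual-vanishes : ∀ {e} → b < e → ∀ j → R e j (suc (e ℕ.+ j)) ≡ 0ℚ
  residual-vanishes b<e j = ∑-zero (comps j) (λ γ → cong (λ L → ∑ L (Ψ _)) (consResidual-< (qshDual γ β) b<e))
  residual-hSum : ∀ {e} → e ≤ b →
    ∑[ j < M ∸ e ] R e j (suc (e ℕ.+ j)) ≡ hSum β (λ j δ → Ψ (j ℕ.+ suc e) (cons⁺ (b ∸ e) δ))
  residual-hSum {e} e≤b = begin
    ∑[ j < M ∸ e ] R e j (suc (e ℕ.+ j))
      ≡⟨ ∑<-cong (M ∸ e) (λ j → ∑-cong (comps j) (λ γ → ∑-consResidual e≤b (qshDual γ β) _)) ⟩
    hSumUpTo (M ∸ e) β (λ j δ → Ψ (suc (e ℕ.+ j)) (cons⁺ (b ∸ e) δ))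
      ≡⟨ hSumUpTo-truncate β _ β<M∸e ⟩
    hSum β (λ j δ → Ψ (suc (e ℕ.+ j)) (cons⁺ (b ∸ e) δ))
      ≡⟨ hSum-cong β (λ j δ → cong (λ n → Ψ n (cons⁺ (b ∸ e) δ)) (trans (cong suc (ℕₚ.+-comm e j)) (sym (ℕₚ.+-suc j e)))) ⟩
    hSum β (λ j δ → Ψ (j ℕ.+ suc e) (cons⁺ (b ∸ e) δ))
      ∎
    where
    β<M∸e : suc (size β) ≤ M ∸ e
    β<M∸e = ℕₚ.m+n≤o⇒m≤o∸n (suc (size β))
              (s≤s (subst (ℕ._≤ b ℕ.+ size β) (ℕₚ.+-comm e (size β)) (ℕₚ.+-monoˡ-≤ (size β) e≤b)))

hSum-cons⁺ : (b : ℕ) (β : Comp) (Ψ : ℕ → Comp → ℚ) →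
             hSum (cons⁺ b β) Ψ ≡ ∑[ d < suc b ] hSum β (λ j δ → Ψ (j ℕ.+ d) (cons⁺ (b ∸ d) δ))
hSum-cons⁺ zero    β Ψ = trans (hSum-cong β (λ j δ → cong (λ n → Ψ n δ) (sym (ℕₚ.+-identityʳ j))))
                               (sym (ℚₚ.+-identityʳ _))
hSum-cons⁺ (suc b) β Ψ = begin
  hSum (suc b ∷ β) Ψ
    ≡⟨ ∑<-cong (suc M) (λ j → trans (∑-cong (comps j) (λ γ → ∑-qshDual-∷ γ (suc b) β (Ψ j))) (∑-+ (comps j) (headᵍ j) (restᵍ j))) ⟩
  ∑[ j < suc M ] (head j + rest j)
    ≡⟨ ∑<-+ (suc M) head rest ⟩
  hSumUpTo (suc M) β (λ j δ → Ψ j (suc b ∷ δ)) + ∑< (suc M) rest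
    ≡⟨ cong₂ _+_ (trans (hSumUpTo-truncate β (λ j δ → Ψ j (suc b ∷ δ)) (s≤s (ℕₚ.m≤n⇒m≤1+n (ℕₚ.m≤n+m (size β) b))))
                        (hSum-cong β (λ j δ → cong (λ n → Ψ n (suc b ∷ δ)) (sym (ℕₚ.+-identityʳ j)))))
                 (hSum-residual b β Ψ) ⟩
  hSum β (λ j δ → Ψ (j ℕ.+ 0) (suc b ∷ δ)) + ∑[ e < suc b ] hSum β (λ j δ → Ψ (j ℕ.+ suc e) (cons⁺ (b ∸ e) δ))
    ∎
  where
  M : ℕ
  M = suc (b ℕ.+ size β)
  headᵍ restᵍ : ℕ → Comp → ℚ
  headᵍ j γ = ∑[ δ ∈ qshDual γ β ] Ψ j (suc b ∷ δ)
  restᵍ j γ = residual γ (suc b) β (Ψ j)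
  head rest : ℕ → ℚ
  head j = ∑ (comps j) (headᵍ j)
  rest j = ∑ (comps j) (restᵍ j)

eSumUpTo : ℕ → Comp → (ℕ → Comp → ℚ) → ℚ
eSumUpTo N α G = ∑[ i < N ] (sign i * ∑ (qshDual (replicate i 1) α) (G i))

eSum : Comp → (ℕ → Comp → ℚ) → ℚ
eSum α = eSumUpTo (suc (size α)) α

eSumUpTo-truncate : {N : ℕ} (α : Comp) (G : ℕ → Comp → ℚ) → suc (size α) ≤ N → eSumUpTo N α G ≡ eSum α G
eSumUpTo-truncate α G α<N = ∑<-truncate _ α<N vanish
  where
  size-replicate : (i : ℕ) → size (replicate i 1) ≡ i
  size-replicate zero    = refl
  size-replicate (suc i) = cong suc (size-replicate i)
  vanish : ∀ {i} → suc (size α) ≤ i → sign i * ∑ (qshDual (replicate i 1) α) (G i) ≡ 0ℚ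
  vanish {i} α<i = trans
    (cong (λ L → sign i * ∑ L (G i)) (qshDual-vanishes (replicate i 1) α (subst (size α <_) (sym (size-replicate i)) α<i)))
    (ℚₚ.*-zeroʳ (sign i))

eSum-congᴵ : {α : Comp} {G G′ : ℕ → Comp → ℚ} → IsComp α →
             (∀ i {β} → IsComp β → G i β ≡ G′ i β) → eSum α G ≡ eSum α G′
eSum-congᴵ {α} α⁺ G≡G′ = ∑<-cong (suc (size α)) (λ i →
  cong (sign i *_) (∑-congᴬ (qshDual-isComp (replicate i 1) α⁺) (G≡G′ i)))

eSum-− : (α : Comp) (G G′ : ℕ → Comp → ℚ) → eSum α G + - eSum α G′ ≡ eSum α (λ i β → G i β + - G′ i β)
eSum-− α G G′ = sym (begin
  eSum α (λ i β → G i β + - G′ i β)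
    ≡⟨ ∑<-cong N (λ i → trans (cong (sign i *_) (trans (∑-+ (D i) (G i) (λ β → - G′ i β)) (cong (∑ (D i) (G i) +_) (∑-neg (D i) (G′ i)))))
                              (solve 3 (λ s x y → s :* (x :+ (:- y)) := s :* x :+ (:- (s :* y))) refl (sign i) (∑ (D i) (G i)) (∑ (D i) (G′ i)))) ⟩
  ∑[ i < N ] (sign i * ∑ (D i) (G i) + - (sign i * ∑ (D i) (G′ i)))
    ≡⟨ trans (∑<-+ N (λ i → sign i * ∑ (D i) (G i)) (λ i → - (sign i * ∑ (D i) (G′ i))))
             (cong (eSum α G +_) (∑<-neg N (λ i → sign i * ∑ (D i) (G′ i)))) ⟩
  eSum α G + - eSum α G′
    ∎)
  where
  N : ℕ
  N = suc (size α)
  D : ℕ → List Comp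
  D i = qshDual (replicate i 1) α

eSumUpTo-∷ : (N a : ℕ) (α : Comp) (G : ℕ → Comp → ℚ) →
  eSumUpTo (suc N) (suc a ∷ α) G ≡ eSumUpTo (suc N) α (λ i β → G i (suc a ∷ β)) + - eSumUpTo N α (λ i β → G (suc i) (cons⁺ a β))
eSumUpTo-∷ N a α G = begin
  X₀ + ∑[ i < N ] (- sign i * ∑ (qshDual (replicate (suc i) 1) (suc a ∷ α)) (G (suc i)))
    ≡⟨ cong (X₀ +_) (∑<-cong N (λ i → cong (- sign i *_) (∑-qshDual-∷ (replicate (suc i) 1) (suc a) α (G (suc i))))) ⟩
  X₀ + ∑[ i < N ] (- sign i * (A i + B i))
    ≡⟨ cong (X₀ +_) (∑<-cong N (λ i → solve 3 (λ s x y → (:- s) :* (x :+ y) := (:- s) :* x :+ (:- (s :* y))) refl (sign i) (A i) (B i))) ⟩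
  X₀ + ∑[ i < N ] (- sign i * A i + - (sign i * B i))
    ≡⟨ cong (X₀ +_) (trans (∑<-+ N (λ i → - sign i * A i) (λ i → - (sign i * B i)))
                             (cong (∑[ i < N ] (- sign i * A i) +_) (∑<-neg N (λ i → sign i * B i)))) ⟩
  X₀ + (∑[ i < N ] (- sign i * A i) + - ∑[ i < N ] (sign i * B i))
    ≡⟨ ℚₚ.+-assoc X₀ _ _ ⟨
  (X₀ + ∑[ i < N ] (- sign i * A i)) + - ∑[ i < N ] (sign i * B i)
    ≡⟨ cong (λ y → (X₀ + ∑[ i < N ] (- sign i * A i)) + - y)
            (∑<-cong N (λ i → cong (sign i *_) (∑-consResidual (s≤s (z≤n {a})) (qshDual (replicate i 1) α) (G (suc i))))) ⟩
  eSumUpTo (suc N) α (λ i β → G i (suc a ∷ β)) + - eSumUpTo N α (λ i β → G (suc i) (cons⁺ a β))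
    ∎
  where
  X₀ : ℚ
  X₀ = 1ℚ * (G 0 (suc a ∷ α) + 0ℚ)
  A B : ℕ → ℚ
  A i = ∑[ δ ∈ qshDual (replicate (suc i) 1) α ] G (suc i) (suc a ∷ δ)
  B i = residual (replicate (suc i) 1) (suc a) α (G (suc i))

eSum-∷ : (a : ℕ) (α : Comp) (G : ℕ → Comp → ℚ) →
         eSum (suc a ∷ α) G ≡ eSum α (λ i β → G i (suc a ∷ β)) + - eSum α (λ i β → G (suc i) (cons⁺ a β))
eSum-∷ a α G = trans (eSumUpTo-∷ (suc (a ℕ.+ size α)) a α G) (cong₂ (λ x y → x + - y)
  (eSumUpTo-truncate α (λ i β → G i (suc a ∷ β)) (s≤s (ℕₚ.m≤n⇒m≤1+n (ℕₚ.m≤n+m (size α) a))))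
  (eSumUpTo-truncate α (λ i β → G (suc i) (cons⁺ a β)) (s≤s (ℕₚ.m≤n+m (size α) a))))

eSum-hSum-cancel : (Φ : ℕ → Comp → ℚ) {α : Comp} → IsComp α →
                   eSum α (λ i β → hSum β (λ j → Φ (i ℕ.+ j))) ≡ Φ 0 α
eSum-hSum-cancel Φ [] =
  solve 1 (λ x → con 1ℚ :* ((((x :+ con 0ℚ) :+ con 0ℚ) :+ con 0ℚ) :+ con 0ℚ) :+ con 0ℚ := x) refl (Φ 0 [])
eSum-hSum-cancel Φ {suc a ∷ α} (_ ∷ α⁺) = begin
  eSum (suc a ∷ α) G
    ≡⟨ eSum-∷ a α G ⟩
  eSum α (λ i β → G i (suc a ∷ β)) + - eSum α (λ i β → G (suc i) (cons⁺ a β))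
    ≡⟨ eSum-− α (λ i β → G i (suc a ∷ β)) (λ i β → G (suc i) (cons⁺ a β)) ⟩
  eSum α (λ i β → G i (suc a ∷ β) + - G (suc i) (cons⁺ a β))
    ≡⟨ eSum-congᴵ α⁺ (λ i {β} _ → telescope i β) ⟩
  eSum α (λ i β → hSum β (λ j δ → Φ (i ℕ.+ j) (suc a ∷ δ)))
    ≡⟨ eSum-hSum-cancel (λ n δ → Φ n (suc a ∷ δ)) α⁺ ⟩
  Φ 0 (suc a ∷ α)
    ∎
  where
  G : ℕ → Comp → ℚ
  G i β = hSum β (λ j → Φ (i ℕ.+ j))
  -- The terms of G i (suc a ∷ β) in which suc a absorbs the first part of the composition
  -- indexing h_j are exactly those of G (suc i) (cons⁺ a β).
  telescope : ∀ i β → G i (suc a ∷ β) + - G (suc i) (cons⁺ a β) ≡ hSum β (λ j δ → Φ (i ℕ.+ j) (suc a ∷ δ))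
  telescope i β = begin
    G i (suc a ∷ β) + - G (suc i) (cons⁺ a β)
      ≡⟨ cong₂ (λ u v → u + - v) (hSum-cons⁺ (suc a) β (λ j → Φ (i ℕ.+ j))) (hSum-cons⁺ a β (λ j → Φ (suc i ℕ.+ j))) ⟩
    (X + Y) + - Y′
      ≡⟨ cong (λ v → (X + Y) + - v) (∑<-cong (suc a) (λ d → hSum-cong β (λ j δ →
           cong (λ n → Φ n (cons⁺ (a ∸ d) δ)) (sym (trans (cong (i ℕ.+_) (ℕₚ.+-suc j d)) (ℕₚ.+-suc i (j ℕ.+ d))))))) ⟩
    (X + Y) + - Y
      ≡⟨ solve 2 (λ x y → (x :+ y) :+ (:- y) := x) refl X Y ⟩
    X
      ≡⟨ hSum-cong β (λ j δ → cong (λ n → Φ (i ℕ.+ n) (suc a ∷ δ)) (ℕₚ.+-identityʳ j)) ⟩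
    hSum β (λ j δ → Φ (i ℕ.+ j) (suc a ∷ δ))
      ∎
    where
    X Y Y′ : ℚ
    X  = hSum β (λ j δ → Φ (i ℕ.+ (j ℕ.+ 0)) (suc a ∷ δ))
    Y  = ∑[ d < suc a ] hSum β (λ j δ → Φ (i ℕ.+ (j ℕ.+ suc d)) (cons⁺ (a ∸ d) δ))
    Y′ = ∑[ d < suc a ] hSum β (λ j δ → Φ (suc i ℕ.+ (j ℕ.+ d)) (cons⁺ (a ∸ d) δ))

𝔹ᵀ-cong : (m : ℤ) {W W′ : Weight} → (∀ k β → W k β ≡ W′ k β) → ∀ k α → 𝔹ᵀ m W k α ≡ 𝔹ᵀ m W′ k α
𝔹ᵀ-cong m {W} {W′} W≡W′ k α = ∑<-cong (suc (size α)) (λ i → cong (sign i *_)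
  (∑-cong (compsUpTo (size α)) (λ β → cong (pairH α (F1n i ·M β) *_) (Hmulᵀ-cong (m ℤ.+ ℤ.+ i) β))))
  where
  Hmulᵀ-cong : (n : ℤ) (β : Comp) → Hmulᵀ n W k β ≡ Hmulᵀ n W′ k β
  Hmulᵀ-cong (ℤ.+ zero)  β = W≡W′ k β
  Hmulᵀ-cong (ℤ.+ suc j) β = W≡W′ k (suc j ∷ β)
  Hmulᵀ-cong -[1+ _ ]    β = refl

𝔹̃ᵀ-hSum : (m : ℤ) (W : Weight) (k : ℕ) {β : Comp} → IsComp β →
          𝔹̃ᵀ m W k β ≡ hSum β (λ j → 𝔹ᵀ (m ℤ.+ ℤ.+ j) (shift j W) k)
𝔹̃ᵀ-hSum m W k {β} β⁺ = ∑<-cong (suc (size β)) (λ j →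
  trans (ℚₚ.*-identityˡ _) (perpᵀ-Fn j (𝔹ᵀ (m ℤ.+ ℤ.+ j) (shift j W) k) β⁺))

RHSᵀ-eSum : (m : ℤ) (W : Weight) (k : ℕ) {α : Comp} → IsComp α →
            RHSᵀ m W k α ≡ eSum α (λ i → 𝔹̃ᵀ (m ℤ.+ ℤ.+ i) (shift i W) k)
RHSᵀ-eSum m W k {α} α⁺ = ∑<-cong (suc (size α)) (λ i →
  cong (sign i *_) (perpᵀ-F1n i (𝔹̃ᵀ (m ℤ.+ ℤ.+ i) (shift i W) k) α⁺))

𝔹ᵀ≡RHSᵀ : (m : ℤ) (W : Weight) (k : ℕ) {α : Comp} → IsComp α → 𝔹ᵀ m W k α ≡ RHSᵀ m W k α
𝔹ᵀ≡RHSᵀ m W k {α} α⁺ = sym (begin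
  RHSᵀ m W k α
    ≡⟨ RHSᵀ-eSum m W k α⁺ ⟩
  eSum α (λ i → 𝔹̃ᵀ (m ℤ.+ ℤ.+ i) (shift i W) k)
    ≡⟨ eSum-congᴵ α⁺ (λ i {β} β⁺ → trans (𝔹̃ᵀ-hSum (m ℤ.+ ℤ.+ i) (shift i W) k β⁺) (hSum-cong β (reassoc i))) ⟩
  eSum α (λ i β → hSum β (λ j → Φ (i ℕ.+ j)))
    ≡⟨ eSum-hSum-cancel Φ α⁺ ⟩
  Φ 0 α
    ≡⟨ cong (λ n → 𝔹ᵀ n W k α) (ℤₚ.+-identityʳ m) ⟩
  𝔹ᵀ m W k α
    ∎)
  where
  Φ : ℕ → Comp → ℚ
  Φ n = 𝔹ᵀ (m ℤ.+ ℤ.+ n) (shift n W) k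
  reassoc : ∀ i j δ → 𝔹ᵀ ((m ℤ.+ ℤ.+ i) ℤ.+ ℤ.+ j) (shift j (shift i W)) k δ ≡ Φ (i ℕ.+ j) δ
  reassoc i j δ = trans (cong (λ n → 𝔹ᵀ n (shift j (shift i W)) k δ) (ℤₚ.+-assoc m (ℤ.+ i) (ℤ.+ j)))
                        (𝔹ᵀ-cong (m ℤ.+ ℤ.+ (i ℕ.+ j)) (λ k′ β → cong (λ n → W n β) (sym (ℕₚ.+-assoc i j k′))) k δ)

proposition4p13 : (m : ℤ) (x : Elem) → All (λ { (c , k , α) → IsComp α }) x →
                  𝔹 m x ≈ RHS m x
proposition4p13 m x x⁺ k γ = begin
  coeff k γ (𝔹 m x)          ≡⟨ coeff-as-pairing k γ (𝔹 m x) ⟩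
  ⟪ 𝔹 m x , δ k γ ⟫          ≡⟨ pairing-𝔹 m x (δ k γ) ⟩
  ⟪ x , 𝔹ᵀ m (δ k γ) ⟫       ≡⟨ ∑-congᴬ x⁺ (λ { {c , k′ , α} α⁺ → cong (c *_) (𝔹ᵀ≡RHSᵀ m (δ k γ) k′ α⁺) }) ⟩
  ⟪ x , RHSᵀ m (δ k γ) ⟫     ≡⟨ pairing-RHS m x (δ k γ) ⟨
  ⟪ RHS m x , δ k γ ⟫        ≡⟨ coeff-as-pairing k γ (RHS m x) ⟨
  coeff k γ (RHS m x)        ∎
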